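{- (i) A $\mathsf{BST}^{\otimes}$-conjunction is finitely satisfiable if and only if it is hereditarily finitely satisfiable. (ii) A $\mathsf{BST}^{\otimes}$-conjunction $\Phi$ with $n$ distinct variables is (hereditarily) finitely satisfiable if and only if it is fulfilled by an accessible ordered $\otimes$-graph of size at most $2^{n}-1$.
   Context: Sets are elements of the von Neumann universe of well-founded sets; $\mathsf{HF}$ denotes the set of hereditarily finite sets. For sets $s,t$, $s\otimes t:=\{\{u,v\} : u\in s,\ v\in t\}$. A $\mathsf{BST}^{\otimes}$-conjunction is a finite conjunction of literals of the forms $x=y\cup z$, $x=y\setminus z$, $x=y\otimes z$, $x\neq y$, with $x,y,z$ set variables; $\mathrm{Vars}(\Phi)$ is its set of variables. A model is an assignment $M$ of well-founded sets to the variables making all literals true under the usual interpretation. $\Phi$ is finitely satisfiable if it has a model $M$ whose set domain $\bigcup_{v}Mv$ is finite, and hereditarily finitely satisfiable if it has a model with all $Mv\in\mathsf{HF}$. A $\otimes$-graph $\mathcal{G}=(\mathcal{P},\mathcal{N},\mathcal{T})$ consists of a set $\mathcal{P}$ of places, the set of nodes $\mathcal{N}=\mathcal{P}\otimes\mathcal{P}$ (the nonempty subsets of $\mathcal{P}$ of size at most 2), with $\mathcal{P}\cap\mathcal{N}=\emptyset$, and a target map $\mathcal{T}:\mathcal{N}\to\mathcal{P}(\mathcal{P})$ (power set). Its size is $|\mathcal{P}|$. A source place is a place belonging to no $\mathcal{T}(B)$. The accessible places form the least set containing the source places and such that if all places of a node $B$ are accessible then all of $\mathcal{T}(B)$ are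 accessible; $\mathcal{G}$ is accessible if all places are accessible. A topological $\otimes$-order is a total order $\prec$ on $\mathcal{P}$ such that $\max_\prec A\prec\max_\prec\mathcal{T}(A)$ for every node $A$ with $\mathcal{T}(A)\neq\emptyset$; an ordered $\otimes$-graph is a $\otimes$-graph endowed with a topological $\otimes$-order. An accessible $\otimes$-graph fulfills $\Phi$ if there is $\mathfrak{F}:\mathrm{Vars}(\Phi)\to\mathcal{P}(\mathcal{P})$ with: (a) $\mathfrak{F}(x)=\mathfrak{F}(y)\star\mathfrak{F}(z)$ for each conjunct $x=y\star z$, $\star\in\{\cup,\setminus\}$; (b) $\mathfrak{F}(x)\neq\mathfrak{F}(y)$ for each conjunct $x\neq y$; (c) for each conjunct $x=y\otimes z$: (c1) $\emptyset\neq\mathcal{T}(\{\upsilon,\zeta\})\subseteq\mathfrak{F}(x)$ for all $\upsilon\in\mathfrak{F}(y),\zeta\in\mathfrak{F}(z)$; (c2) $\mathfrak{F}(x)\subseteq\bigcup\{\mathcal{T}(B):B\in\mathfrak{F}(y)\otimes\mathfrak{F}(z)\}$; (c3) $\bigcup\{\mathcal{T}(B):B\in\mathcal{N}\setminus(\mathfrak{F}(y)\otimes\mathfrak{F}(z))\}\cap\mathfrak{F}(x)=\emptyset$. -}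

module Defs where

open import Level using (0ℓ) renaming (suc to lsuc)
open import Data.Bool using (Bool; if_then_else_)
open import Data.Nat using (ℕ; _≤_; _^_; _∸_)
open import Data.Fin using (Fin)
open import Data.Fin.Subset using (Subset; _∈_; _∉_; _⊆_; _∪_; _─_; Nonempty)
open import Data.List using (List)
open import Data.List.Relation.Unary.All using (All)
open import Data.List.Relation.Unary.Any using (Any)
open import Data.Product using (Σ; _×_)
open import Data.Sum using (_⊎_)
open import Relation.Nullary using (¬_)
open import Relation.Binary.PropositionalEquality using (_≡_; _≢_)
open import Relation.Binary.Structures using (IsStrictTotalOrder)

-- The universe of well-founded sets (Aczel's iterative sets).
-- Every element is well-founded by construction (inductive type).

data V : Set₁ where
  sup : (I : Set) → (I → V) → V

infix 4 _≐_ _∈V_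
_≐_ : V → V → Set
sup I f ≐ sup J g =
  ((i : I) → Σ J λ j → f i ≐ g j) × ((j : J) → Σ I λ i → f i ≐ g j)

_∈V_ : V → V → Set
x ∈V sup I f = Σ I λ i → x ≐ f i

pairV : V → V → V
pairV u v = sup Bool (λ b → if b then u else v)

IsUnion : V → V → V → Set₁
IsUnion x y z = ∀ w → (w ∈V x → (w ∈V y ⊎ w ∈V z)) × ((w ∈V y ⊎ w ∈V z) → w ∈V x)

IsDiff : V → V → V → Set₁
IsDiff x y z = ∀ w → (w ∈V x → (w ∈V y × ¬ (w ∈V z))) × ((w ∈V y × ¬ (w ∈V z)) → w ∈V x)

InTensorV : V → V → V → Set₁
InTensorV w y z = Σ V λ u → Σ V λ v → u ∈V y × v ∈V z × (w ≐ pairV u v)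

IsTensor : V → V → V → Set₁
IsTensor x y z = ∀ w → (w ∈V x → InTensorV w y z) × (InTensorV w y z → w ∈V x)

data Literal (n : ℕ) : Set where
  union  : Fin n → Fin n → Fin n → Literal n
  diff   : Fin n → Fin n → Fin n → Literal n
  tensor : Fin n → Fin n → Fin n → Literal n
  neq    : Fin n → Fin n → Literal n

Conj : ℕ → Set
Conj n = List (Literal n)

data OccursIn {n : ℕ} (v : Fin n) : Literal n → Set where
  union₁ : ∀ {y z} → OccursIn v (union v y z)
  union₂ : ∀ {x z} → OccursIn v (union x v z)
  union₃ : ∀ {x y} → OccursIn v (union x y v)
  diff₁ : ∀ {y z} → OccursIn v (diff v y z)
  diff₂ : ∀ {x z} → OccursIn v (diff x v z)
  diff₃ : ∀ {x y} → OccursIn v (diff x y v)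
  tensor₁ : ∀ {y z} → OccursIn v (tensor v y z)
  tensor₂ : ∀ {x z} → OccursIn v (tensor x v z)
  tensor₃ : ∀ {x y} → OccursIn v (tensor x y v)
  neq₁ : ∀ {y} → OccursIn v (neq v y)
  neq₂ : ∀ {x} → OccursIn v (neq x v)

-- Vars(Φ) = Fin n, i.e. Φ has exactly n distinct variables
AllVarsOccur : ∀ {n} → Conj n → Set
AllVarsOccur {n} Φ = (v : Fin n) → Any (OccursIn v) Φ

HoldsV : ∀ {n} → (Fin n → V) → Literal n → Set₁
HoldsV M (union x y z)  = IsUnion (M x) (M y) (M z)
HoldsV M (diff x y z)   = IsDiff (M x) (M y) (M z)
HoldsV M (tensor x y z) = IsTensor (M x) (M y) (M z)
HoldsV M (neq x y)      = Level.Lift (lsuc 0ℓ) (¬ (M x ≐ M y))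

IsModel : ∀ {n} → Conj n → (Fin n → V) → Set₁
IsModel Φ M = All (HoldsV M) Φ

-- the set domain ⋃_v M v is finite: it is covered by a finite list of sets
FiniteDomain : ∀ {n} → (Fin n → V) → Set₁
FiniteDomain {n} M =
  Σ ℕ λ m → Σ (Fin m → V) λ g →
    (v : Fin n) (w : V) → w ∈V M v → Σ (Fin m) λ i → w ≐ g i

FinitelySatisfiable : ∀ {n} → Conj n → Set₁
FinitelySatisfiable {n} Φ = Σ (Fin n → V) λ M → IsModel Φ M × FiniteDomain M

data IsHF : V → Set₁ where
  hf : ∀ {x} (m : ℕ) (f : Fin m → V) → ((i : Fin m) → IsHF (f i)) →
       x ≐ sup (Fin m) f → IsHF x

HerFinSatisfiable : ∀ {n} → Conj n → Set₁
HerFinSatisfiable {n} Φ =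
  Σ (Fin n → V) λ M → IsModel Φ M × ((v : Fin n) → IsHF (M v))

-- ⊗-graphs with places Fin k.  A node {i,j} (i = j allowed, giving {i})
-- is represented by the pair (i , j); T is required to be symmetric so
-- that it is a function of the unordered node.

record OGraph (k : ℕ) : Set where
  field
    T     : Fin k → Fin k → Subset k
    T-sym : (i j : Fin k) → T i j ≡ T j i

module _ {k : ℕ} (G : OGraph k) where
  open OGraph G

  IsSource : Fin k → Set
  IsSource p = (i j : Fin k) → p ∉ T i j

  data AccessiblePlace : Fin k → Set where
    source : ∀ {p} → IsSource p → AccessiblePlace p
    fire   : ∀ {p} (i j : Fin k) → AccessiblePlace i → AccessiblePlace j →
             p ∈ T i j → AccessiblePlace p

  Accessible : Set
  Accessible = (p : Fin k) → AccessiblePlace p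

  -- topological ⊗-order: a strict total order ≺ on places with
  -- max≺ {i,j} ≺ max≺ T({i,j}) whenever T({i,j}) ≠ ∅, written out as:
  -- some q ∈ T({i,j}) lies strictly above both i and j.
  record TopologicalOrder : Set₁ where
    field
      _≺_   : Fin k → Fin k → Set
      isSTO : IsStrictTotalOrder _≡_ _≺_
      topo  : (i j : Fin k) → Nonempty (T i j) →
              Σ (Fin k) λ q → q ∈ T i j × i ≺ q × j ≺ q

  NodeIn⊗ : Subset k → Subset k → Fin k → Fin k → Set
  NodeIn⊗ Y Z i j = Σ (Fin k) λ u → Σ (Fin k) λ v → u ∈ Y × v ∈ Z ×
                      ((i ≡ u × j ≡ v) ⊎ (i ≡ v × j ≡ u))

  FulfillsLit : ∀ {n} → (Fin n → Subset k) → Literal n → Set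
  FulfillsLit F (union x y z) = F x ≡ F y ∪ F z
  FulfillsLit F (diff x y z)  = F x ≡ F y ─ F z
  FulfillsLit F (neq x y)     = F x ≢ F y
  FulfillsLit F (tensor x y z) =
    ((u v : Fin k) → u ∈ F y → v ∈ F z → Nonempty (T u v) × T u v ⊆ F x) ×
    ((p : Fin k) → p ∈ F x →
       Σ (Fin k) λ i → Σ (Fin k) λ j → NodeIn⊗ (F y) (F z) i j × p ∈ T i j) ×
    ((i j : Fin k) → ¬ NodeIn⊗ (F y) (F z) i j →
       (p : Fin k) → p ∈ T i j → p ∉ F x)

  Fulfills : ∀ {n} → Conj n → Set
  Fulfills {n} Φ = Σ (Fin n → Subset k) λ F → All (FulfillsLit F) Φ

FulfilledBySmallGraph : ∀ {n} → Conj n → Set₁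
FulfilledBySmallGraph {n} Φ =
  Σ ℕ λ k → (k ≤ 2 ^ n ∸ 1) × Σ (OGraph k) λ G →
    Accessible G × TopologicalOrder G × Fulfills G Φ

{-# OPTIONS --safe #-}
module Submission where

-- Hereditarily finite models have finite domains; the rest goes through ⊗-graphs.
-- From a model with finite domain, take as places the nonempty Venn regions met by
-- the domain (at most 2^n - 1 of them), let x denote the regions inside M x, and let a
-- node {p,q} forced by a conjunct x = y ⊗ z target the regions of the pairs {a,b} with
-- a at p and b at q; the ∈-depth of domain elements yields a topological order.
-- Conversely, from an accessible ordered ⊗-graph build hereditarily finite sets place by
-- place: every place gets a seed (a fresh atom at a source, the pair of two seeds along
-- an accessibility derivation otherwise), and every pair {u,v} drawn from a forced node
-- is put at a target lying above both places of the node.  The order makes this a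
-- well-founded construction in which each element has exactly one place, so letting
-- M x collect the elements of the places in F x gives a model.

open import Defs
open import Level using (0ℓ; lift; lower) renaming (suc to lsuc)
open import Axiom.ExcludedMiddle using (ExcludedMiddle)
open import Data.Bool using (true; false)
open import Data.Empty using (⊥-elim)
open import Data.Nat using (ℕ; zero; suc; _+_; _*_; _<_; _≤_; _∸_; _^_; s≤s)
import Data.Nat.Properties as ℕ
open import Data.Fin using (Fin; toℕ) renaming (zero to fzero; suc to fsuc)
import Data.Fin.Properties as Fin
open import Data.Fin.Subset using (Subset; inside; outside; _∈_; _∉_; _⊆_; _∪_; _─_; Nonempty; ⊥; ∣_∣)
open import Data.Fin.Subset.Properties
  using (⊆-antisym; _∈?_; ∉⊥; nonempty?; p⊂q⇒∣p∣<∣q∣; ∣⊤∣≡n; ⊆⊤; ∈⊤;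
         x∈p∪q⁺; x∈p∪q⁻; x∈p∧x∉q⇒x∈p─q; p─q⊆p)
open import Data.Vec as Vec using (_∷_; tabulate; here; there)
open import Data.Vec.Properties using (lookup∘tabulate; []=⇒lookup; lookup⇒[]=)
open import Data.List as List using (List; []; _∷_; _++_; length; concat; cartesianProductWith)
open import Data.List.Properties using (length-++; length-map; filter-notAll; map-cong)
open import Data.List.Extrema.Nat using (max; v<max⁺; argmax; argmax-all; f[xs]≤f[argmax])
open import Data.List.Membership.Propositional using (lose) renaming (_∈_ to _∈ˡ_)
open import Data.List.Relation.Binary.Subset.Propositional using () renaming (_⊆_ to _⊆ˡ_)
open import Data.List.Membership.Propositional.Properties
  using (∈-++⁺ˡ; ∈-++⁺ʳ; ∈-++⁻; ∈-map⁺; ∈-map⁻; ∈-filter⁺; ∈-filter⁻; ∈-lookup; ∈-allFin;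
         ∈-concat⁺′; ∈-concat⁻′; ∈-tabulate⁺; ∈-tabulate⁻; ∈-cartesianProductWith⁺)
open import Data.List.Relation.Unary.Any as Any using (Any; here; there)
open import Data.List.Relation.Unary.Any.Properties using (lookup-index; concat⁺; tabulate⁺; map⁺)
open import Data.List.Relation.Unary.All as All using (All)
open import Data.List.Relation.Unary.All.Properties using (all-filter)
open import Data.Product using (Σ; _×_; _,_; proj₁; proj₂)
open import Data.Sum as Sum using (_⊎_; inj₁; inj₂; swap; [_,_]′)
open import Function using (_∘_; id; flip; _on_)
open import Function.Bundles using (_⇔_; mk⇔; Equivalence)
open import Function.Definitions using (Injective)
open import Relation.Nullary using (¬_; Dec; yes; no; does)
open import Relation.Nullary.Decidable using (dec-true; map′)
open import Relation.Unary using (Decidable)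
open import Relation.Binary.Definitions using (Tri; tri<; tri≈; tri>)
open import Relation.Binary.Structures using (IsStrictTotalOrder)
open import Relation.Binary.PropositionalEquality
  using (_≡_; _≢_; refl; sym; trans; cong; cong₂; subst; subst₂; isEquivalence; module ≡-Reasoning)

lowerEM : ExcludedMiddle (lsuc 0ℓ) → ExcludedMiddle 0ℓ
lowerEM em = map′ lower lift em

module _ {k ℓ} {P : Fin k → Set ℓ} (P? : Decidable P) where

  subsetOf : Subset k
  subsetOf = tabulate (does ∘ P?)

  ∈-subsetOf⁺ : ∀ {p} → P p → p ∈ subsetOf
  ∈-subsetOf⁺ {p} h = lookup⇒[]= p subsetOf (trans (lookup∘tabulate _ p) (dec-true (P? p) h))

  ∈-subsetOf⁻ : ∀ {p} → p ∈ subsetOf → P p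
  ∈-subsetOf⁻ {p} h with P? p in eq
  ... | yes Pp = Pp
  ... | no _ with () ← trans (sym ([]=⇒lookup h)) (trans (lookup∘tabulate _ p) (cong does eq))

subsetOf-cong : ∀ {k ℓ ℓ′} {P : Fin k → Set ℓ} {Q : Fin k → Set ℓ′}
  (P? : Decidable P) (Q? : Decidable Q) → (∀ {p} → P p ⇔ Q p) → subsetOf P? ≡ subsetOf Q?
subsetOf-cong P? Q? P⇔Q = ⊆-antisym
  (∈-subsetOf⁺ Q? ∘ Equivalence.to P⇔Q ∘ ∈-subsetOf⁻ P?)
  (∈-subsetOf⁺ P? ∘ Equivalence.from P⇔Q ∘ ∈-subsetOf⁻ Q?)

x∈p─q⇒x∉q : ∀ {n} {x : Fin n} (p q : Subset n) → x ∈ p ─ q → x ∉ q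
x∈p─q⇒x∉q (_ ∷ p) (outside ∷ q) (there x∈p─q) (there x∈q) = x∈p─q⇒x∉q p q x∈p─q x∈q
x∈p─q⇒x∉q (_ ∷ p) (inside ∷ q)  (there x∈p─q) (there x∈q) = x∈p─q⇒x∉q p q x∈p─q x∈q

allSubsets : ∀ n → List (Subset n)
allSubsets zero = List.[ Vec.[] ]
allSubsets (suc n) = List.map (inside ∷_) (allSubsets n) ++ List.map (outside ∷_) (allSubsets n)

∈-allSubsets : ∀ {n} (s : Subset n) → s ∈ˡ allSubsets n
∈-allSubsets Vec.[] = here refl
∈-allSubsets (inside ∷ s) = ∈-++⁺ˡ (∈-map⁺ (inside ∷_) (∈-allSubsets s))
∈-allSubsets {suc n} (outside ∷ s) =
  ∈-++⁺ʳ (List.map (inside ∷_) (allSubsets n)) (∈-map⁺ (outside ∷_) (∈-allSubsets s))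

length-allSubsets : ∀ n → length (allSubsets n) ≡ 2 ^ n
length-allSubsets zero = refl
length-allSubsets (suc n) = begin
  length (List.map (inside ∷_) S ++ List.map (outside ∷_) S)
    ≡⟨ length-++ (List.map (inside ∷_) S) ⟩
  length (List.map (inside ∷_) S) + length (List.map (outside ∷_) S)
    ≡⟨ cong₂ _+_ (length-map _ S) (length-map _ S) ⟩
  length S + length S
    ≡⟨ cong (λ l → l + l) (length-allSubsets n) ⟩
  2 ^ n + 2 ^ n
    ≡⟨ cong (2 ^ n +_) (sym (ℕ.+-identityʳ (2 ^ n))) ⟩
  2 ^ suc n ∎
  where
  S = allSubsets n
  open ≡-Reasoning

≐-refl : ∀ x → x ≐ x
≐-refl (sup I f) = (λ i → i , ≐-refl (f i)) , (λ i → i , ≐-refl (f i))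

≐-sym : ∀ {x y} → x ≐ y → y ≐ x
≐-sym {sup I f} {sup J g} (f⊆g , g⊆f) =
  (λ j → let i , e = g⊆f j in i , ≐-sym e) , (λ i → let j , e = f⊆g i in j , ≐-sym e)

≐-trans : ∀ {x y z} → x ≐ y → y ≐ z → x ≐ z
≐-trans {sup I f} {sup J g} {sup K h} (f⊆g , g⊆f) (g⊆h , h⊆g) =
  (λ i → let j , e = f⊆g i ; l , e′ = g⊆h j in l , ≐-trans e e′) ,
  (λ l → let j , e′ = h⊆g l ; i , e = g⊆f j in i , ≐-trans e e′)

∈V-respˡ : ∀ {w w′ x} → w ≐ w′ → w ∈V x → w′ ∈V x
∈V-respˡ {x = sup I f} e (i , w≐fi) = i , ≐-trans (≐-sym e) w≐fi

∈V-respʳ : ∀ {w x x′} → x ≐ x′ → w ∈V x → w ∈V x′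
∈V-respʳ {x = sup I f} {sup J g} (f⊆g , _) (i , w≐fi) =
  let j , e = f⊆g i in j , ≐-trans w≐fi e

∈V-sup : ∀ {I} (f : I → V) i → f i ∈V sup I f
∈V-sup f i = i , ≐-refl (f i)

≐-ext : ∀ {x y} → (∀ w → w ∈V x → w ∈V y) → (∀ w → w ∈V y → w ∈V x) → x ≐ y
≐-ext {sup I f} {sup J g} x⊆y y⊆x =
  (λ i → x⊆y (f i) (∈V-sup f i)) ,
  (λ j → let i , e = y⊆x (g j) (∈V-sup g j) in i , ≐-sym e)

pairV-cong : ∀ {u v u′ v′} → u ≐ u′ → v ≐ v′ → pairV u v ≐ pairV u′ v′
pairV-cong u≐u′ v≐v′ =
  (λ { true → true , u≐u′ ; false → false , v≐v′ }) ,
  (λ { true → true , u≐u′ ; false → false , v≐v′ })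

pairV-comm : ∀ u v → pairV u v ≐ pairV v u
pairV-comm u v =
  (λ { true → false , ≐-refl u ; false → true , ≐-refl v }) ,
  (λ { true → false , ≐-refl v ; false → true , ≐-refl u })

∈-pairV₁ : ∀ u v → u ∈V pairV u v
∈-pairV₁ u v = true , ≐-refl u

∈-pairV₂ : ∀ u v → v ∈V pairV u v
∈-pairV₂ u v = false , ≐-refl v

∈-pairV⁻ : ∀ {w u v} → w ∈V pairV u v → w ≐ u ⊎ w ≐ v
∈-pairV⁻ (true , e) = inj₁ e
∈-pairV⁻ (false , e) = inj₂ e

≐-join : ∀ {a b w} → a ≐ w → b ≐ w → a ≐ b
≐-join a≐w b≐w = ≐-trans a≐w (≐-sym b≐w)

≐-either : ∀ {a b c d} → a ≐ c → b ≐ c → d ≐ a ⊎ d ≐ b → d ≐ b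
≐-either a≐c b≐c (inj₁ d≐a) = ≐-trans d≐a (≐-join a≐c b≐c)
≐-either a≐c b≐c (inj₂ d≐b) = d≐b

pairV-injective : ∀ {u v u′ v′} → pairV u v ≐ pairV u′ v′ →
  (u ≐ u′ × v ≐ v′) ⊎ (u ≐ v′ × v ≐ u′)
pairV-injective {u} {v} {u′} {v′} e
  with ∈-pairV⁻ (∈V-respʳ e (∈-pairV₁ u v)) | ∈-pairV⁻ (∈V-respʳ e (∈-pairV₂ u v))
... | inj₁ u≐u′ | inj₂ v≐v′ = inj₁ (u≐u′ , v≐v′)
... | inj₂ u≐v′ | inj₁ v≐u′ = inj₂ (u≐v′ , v≐u′)
... | inj₁ u≐u′ | inj₁ v≐u′ =
  let v′∈uv = ∈-pairV⁻ (∈V-respʳ (≐-sym e) (∈-pairV₂ u′ v′)) in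
  inj₁ (u≐u′ , ≐-sym (≐-either u≐u′ v≐u′ v′∈uv))
... | inj₂ u≐v′ | inj₂ v≐v′ =
  let u′∈uv = ∈-pairV⁻ (∈V-respʳ (≐-sym e) (∈-pairV₁ u′ v′)) in
  inj₁ (≐-sym (≐-either v≐v′ u≐v′ (swap u′∈uv)) , v≐v′)

pairV-pigeonhole : ∀ {a b c u v} → a ∈V pairV u v → b ∈V pairV u v → c ∈V pairV u v →
  a ≐ b ⊎ a ≐ c ⊎ b ≐ c
pairV-pigeonhole (true , a≐u) (true , b≐u) _ = inj₁ (≐-join a≐u b≐u)
pairV-pigeonhole (false , a≐v) (false , b≐v) _ = inj₁ (≐-join a≐v b≐v)
pairV-pigeonhole (true , a≐u) (false , _) (true , c≐u) = inj₂ (inj₁ (≐-join a≐u c≐u))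
pairV-pigeonhole (false , a≐v) (true , _) (false , c≐v) = inj₂ (inj₁ (≐-join a≐v c≐v))
pairV-pigeonhole (true , _) (false , b≐v) (false , c≐v) = inj₂ (inj₂ (≐-join b≐v c≐v))
pairV-pigeonhole (false , _) (true , b≐u) (true , c≐u) = inj₂ (inj₂ (≐-join b≐u c≐u))

_⊏_ : V → V → Set₁
u ⊏ sup I f = Σ I λ i → f i ≡ u

⊏-ind : ∀ {ℓ} (P : V → Set ℓ) → (∀ e → (∀ u → u ⊏ e → P u) → P e) → ∀ e → P e
⊏-ind P step (sup I f) = step (sup I f) λ { u (i , refl) → ⊏-ind P step (f i) }

⊏-pairV₁ : ∀ {e u v} → e ≡ pairV u v → u ⊏ e
⊏-pairV₁ refl = true , refl

⊏-pairV₂ : ∀ {e u v} → e ≡ pairV u v → v ⊏ e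
⊏-pairV₂ refl = false , refl

listSet : List V → V
listSet xs = sup (Fin (length xs)) (List.lookup xs)

∈-listSet⁺ : ∀ {w e xs} → e ∈ˡ xs → w ≐ e → w ∈V listSet xs
∈-listSet⁺ e∈xs w≐e = Any.index e∈xs , subst (_ ≐_) (lookup-index e∈xs) w≐e

∈-listSet⁻ : ∀ {w xs} → w ∈V listSet xs → Σ V λ e → e ∈ˡ xs × w ≐ e
∈-listSet⁻ (i , w≐xsᵢ) = _ , ∈-lookup i , w≐xsᵢ

listSet-HF : ∀ {xs} → (∀ {e} → e ∈ˡ xs → IsHF e) → IsHF (listSet xs)
listSet-HF all-HF = hf _ _ (all-HF ∘ ∈-lookup) (≐-refl _)

numeral : ℕ → V
numeral zero = sup (Fin 0) λ ()
numeral (suc c) = sup (Fin 1) λ _ → numeral c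

numeral-injective : ∀ a b → numeral a ≐ numeral b → a ≡ b
numeral-injective zero zero _ = refl
numeral-injective zero (suc b) (_ , b⊆a) with () ← b⊆a fzero
numeral-injective (suc a) zero (a⊆b , _) with () ← a⊆b fzero
numeral-injective (suc a) (suc b) (a⊆b , _) = cong suc (numeral-injective a b (proj₂ (a⊆b fzero)))

-- Three distinct elements, so that no atom is a pair; the third one records c.
atomElement : ℕ → Fin 3 → V
atomElement c fzero = numeral 0
atomElement c (fsuc fzero) = numeral 1
atomElement c (fsuc (fsuc fzero)) = numeral (2 + c)

atom : ℕ → V
atom c = sup (Fin 3) (atomElement c)

atom-injective : ∀ c c′ → atom c ≐ atom c′ → c ≡ c′
atom-injective c c′ (c⊆c′ , _) with c⊆c′ (fsuc (fsuc fzero))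
... | fzero , e with () ← numeral-injective (2 + c) 0 e
... | fsuc fzero , e with () ← numeral-injective (2 + c) 1 e
... | fsuc (fsuc fzero) , e = ℕ.suc-injective (ℕ.suc-injective (numeral-injective (2 + c) (2 + c′) e))

atom-≉-pairV : ∀ c u v → ¬ atom c ≐ pairV u v
atom-≉-pairV c u v e
  with pairV-pigeonhole (element fzero) (element (fsuc fzero)) (element (fsuc (fsuc fzero)))
  where
  element : ∀ i → atomElement c i ∈V pairV u v
  element i = ∈V-respʳ e (∈V-sup (atomElement c) i)
... | inj₁ e₀₁ with () ← numeral-injective 0 1 e₀₁
... | inj₂ (inj₁ e₀₂) with () ← numeral-injective 0 (2 + c) e₀₂
... | inj₂ (inj₂ e₁₂) with () ← numeral-injective 1 (2 + c) e₁₂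

numeral-HF : ∀ c → IsHF (numeral c)
numeral-HF zero = hf 0 (λ ()) (λ ()) (≐-refl _)
numeral-HF (suc c) = hf 1 (λ _ → numeral c) (λ _ → numeral-HF c) (≐-refl _)

atom-HF : ∀ c → IsHF (atom c)
atom-HF c = hf 3 _ elements-HF (≐-refl _)
  where
  elements-HF : ∀ i → IsHF (atomElement c i)
  elements-HF fzero = numeral-HF 0
  elements-HF (fsuc fzero) = numeral-HF 1
  elements-HF (fsuc (fsuc fzero)) = numeral-HF (2 + c)

pairV-HF : ∀ {u v} → IsHF u → IsHF v → IsHF (pairV u v)
pairV-HF {u} {v} hu hv = hf 2 element (λ { fzero → hu ; (fsuc fzero) → hv })
  ((λ { true → fzero , ≐-refl u ; false → fsuc fzero , ≐-refl v }) ,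
   (λ { fzero → true , ≐-refl u ; (fsuc fzero) → false , ≐-refl v }))
  where
  element : Fin 2 → V
  element fzero = u
  element (fsuc fzero) = v

module _ {n} (M : Fin n → V) where

  FiniteDomain-fromList : (xs : List V) → (∀ v w → w ∈V M v → Any (w ≐_) xs) → FiniteDomain M
  FiniteDomain-fromList xs covers = length xs , List.lookup xs , λ v w w∈Mv →
    let w∈xs = covers v w w∈Mv in Any.index w∈xs , lookup-index w∈xs

  HF⇒FiniteDomain : (∀ v → IsHF (M v)) → FiniteDomain M
  HF⇒FiniteDomain hfs = FiniteDomain-fromList (concat (List.tabulate (elements ∘ hfs))) λ v w w∈Mv →
    concat⁺ (tabulate⁺ v (elements-complete (hfs v) w∈Mv))
    where
    elements : ∀ {x} → IsHF x → List V
    elements (hf _ f _ _) = List.tabulate f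
    elements-complete : ∀ {x w} (h : IsHF x) → w ∈V x → Any (w ≐_) (elements h)
    elements-complete (hf _ f _ x≐f) w∈x =
      let i , w≐fi = ∈V-respʳ x≐f w∈x in tabulate⁺ i w≐fi

HF⇒Finite : ∀ {n} {Φ : Conj n} → HerFinSatisfiable Φ → FinitelySatisfiable Φ
HF⇒Finite (M , M⊨Φ , hfs) = M , M⊨Φ , HF⇒FiniteDomain M hfs

module _ {k : ℕ} where

  code : Fin k → ℕ → ℕ
  code p c = c * k + toℕ p

  code-<-mono : ∀ {c c′} (p q : Fin k) → c < c′ → code p c < code q c′
  code-<-mono {c} {c′} p q c<c′ = begin-strict
    c * k + toℕ p   <⟨ ℕ.+-monoʳ-< (c * k) (Fin.toℕ<n p) ⟩
    c * k + k       ≡⟨ ℕ.+-comm (c * k) k ⟩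
    suc c * k       ≤⟨ ℕ.*-monoˡ-≤ k c<c′ ⟩
    c′ * k          ≤⟨ ℕ.m≤m+n (c′ * k) (toℕ q) ⟩
    c′ * k + toℕ q  ∎
    where open ℕ.≤-Reasoning

  code-injective : ∀ {p p′ c c′} → code p c ≡ code p′ c′ → p ≡ p′ × c ≡ c′
  code-injective {p} {p′} {c} {c′} eq with ℕ.<-cmp c c′
  ... | tri< c<c′ _ _ = ⊥-elim (ℕ.<⇒≢ (code-<-mono p p′ c<c′) eq)
  ... | tri> _ _ c′<c = ⊥-elim (ℕ.<⇒≢ (code-<-mono p′ p c′<c) (sym eq))
  ... | tri≈ _ refl _ = Fin.toℕ-injective (ℕ.+-cancelˡ-≡ (c * k) _ _ eq) , refl

<-on-isStrictTotalOrder : ∀ {a} {A : Set a} (f : A → ℕ) → Injective _≡_ _≡_ f →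
  IsStrictTotalOrder _≡_ (_<_ on f)
<-on-isStrictTotalOrder f f-inj = record
  { isStrictPartialOrder = record
    { isEquivalence = isEquivalence
    ; irrefl = λ { refl → ℕ.<-irrefl refl }
    ; trans = ℕ.<-trans
    ; <-resp-≈ = (λ { refl → id }) , (λ { refl → id }) }
  ; compare = λ x y → compare (ℕ.<-cmp (f x) (f y)) }
  where
  compare : ∀ {x y} → Tri (f x < f y) (f x ≡ f y) (f y < f x) → Tri (f x < f y) (x ≡ y) (f y < f x)
  compare (tri< a ¬b ¬c) = tri< a (¬b ∘ cong f) ¬c
  compare (tri≈ ¬a b ¬c) = tri≈ ¬a (f-inj b) ¬c
  compare (tri> ¬a ¬b c) = tri> ¬a (¬b ∘ cong f) c

sort : ∀ {k} → Fin k → Fin k → Fin k × Fin k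
sort i j with i Fin.≤? j
... | yes _ = i , j
... | no _ = j , i

sort-comm : ∀ {k} (i j : Fin k) → sort i j ≡ sort j i
sort-comm i j with i Fin.≤? j | j Fin.≤? i
... | yes i≤j | yes j≤i rewrite Fin.≤-antisym i≤j j≤i = refl
... | yes _ | no _ = refl
... | no _ | yes _ = refl
... | no i≰j | no j≰i = ⊥-elim ([ i≰j , j≰i ]′ (Fin.≤-total i j))

sort-cases : ∀ {k} (i j : Fin k) → sort i j ≡ (i , j) ⊎ sort i j ≡ (j , i)
sort-cases i j with i Fin.≤? j
... | yes _ = inj₁ refl
... | no _ = inj₂ refl

-- A copy of NodeIn⊗, which does not actually depend on its graph argument;
-- unlike NodeIn⊗ it can be used before the graph is built.
Node⊗ : ∀ {k} → Subset k → Subset k → Fin k → Fin k → Set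
Node⊗ {k} Y Z i j = Σ (Fin k) λ u → Σ (Fin k) λ v → u ∈ Y × v ∈ Z ×
  ((i ≡ u × j ≡ v) ⊎ (i ≡ v × j ≡ u))

Node⊗-sym : ∀ {k} {Y Z : Subset k} {i j} → Node⊗ Y Z i j → Node⊗ Y Z j i
Node⊗-sym (u , v , u∈Y , v∈Z , inj₁ (i≡u , j≡v)) = u , v , u∈Y , v∈Z , inj₂ (j≡v , i≡u)
Node⊗-sym (u , v , u∈Y , v∈Z , inj₂ (i≡v , j≡u)) = u , v , u∈Y , v∈Z , inj₁ (j≡u , i≡v)

ForcedNode : ∀ {n k} → Conj n → (Fin n → Subset k) → Fin k → Fin k → Set
ForcedNode {n} Φ F i j = Σ (Fin n) λ x → Σ (Fin n) λ y → Σ (Fin n) λ z →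
  tensor x y z ∈ˡ Φ × Node⊗ (F y) (F z) i j

ForcedNode-sym : ∀ {n k Φ} {F : Fin n → Subset k} {i j} → ForcedNode Φ F i j → ForcedNode Φ F j i
ForcedNode-sym (x , y , z , lit , node) = x , y , z , lit , Node⊗-sym node

module VennGraph (em : ExcludedMiddle (lsuc 0ℓ)) {n} (Φ : Conj n) (M : Fin n → V) (M⊨Φ : IsModel Φ M)
  {m} (g : Fin m → V) (g-covers : ∀ v w → w ∈V M v → Σ (Fin m) λ t → w ≐ g t) where

  decide : ExcludedMiddle 0ℓ
  decide = lowerEM em

  _∈M?_ : ∀ w → Decidable λ v → w ∈V M v
  w ∈M? v = decide

  signature : V → Subset n
  signature w = subsetOf (w ∈M?_)

  ∈-signature⁺ : ∀ {v w} → w ∈V M v → v ∈ signature w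
  ∈-signature⁺ = ∈-subsetOf⁺ (_ ∈M?_)

  ∈-signature⁻ : ∀ {v w} → v ∈ signature w → w ∈V M v
  ∈-signature⁻ = ∈-subsetOf⁻ (_ ∈M?_)

  signature-cong : ∀ {w w′} → w ≐ w′ → signature w ≡ signature w′
  signature-cong {w} {w′} e = subsetOf-cong (w ∈M?_) (w′ ∈M?_) (mk⇔ (∈V-respˡ e) (∈V-respˡ (≐-sym e)))

  Realized : Subset n → Set
  Realized s = Nonempty s × Σ (Fin m) λ t → signature (g t) ≡ s

  realized? : Decidable Realized
  realized? s = decide

  regions : List (Subset n)
  regions = List.filter realized? (allSubsets n)

  k : ℕ
  k = length regions

  k≤2^n∸1 : k ≤ 2 ^ n ∸ 1
  k≤2^n∸1 = subst (λ N → k ≤ N ∸ 1) (length-allSubsets n) (ℕ.∸-monoˡ-≤ 1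
    (filter-notAll realized? (allSubsets n) (lose (∈-allSubsets ⊥) λ ((_ , x∈⊥) , _) → ∉⊥ x∈⊥)))

  region : Fin k → Subset n
  region = List.lookup regions

  region-realized : ∀ p → Realized (region p)
  region-realized p = proj₂ (∈-filter⁻ realized? {xs = allSubsets n} (∈-lookup p))

  _LiesAt_ : V → Fin k → Set
  w LiesAt p = signature w ≡ region p

  LiesAt-resp : ∀ {w w′ p} → w ≐ w′ → w LiesAt p → w′ LiesAt p
  LiesAt-resp e = trans (sym (signature-cong e))

  representative : ∀ p → Σ (Fin m) λ t → g t LiesAt p
  representative p = proj₂ (region-realized p)

  locate : ∀ {v w} → w ∈V M v → Σ (Fin k) (w LiesAt_)
  locate {v} {w} w∈Mv =
    let t , w≐gt = g-covers v w w∈Mv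
        realized = (v , ∈-signature⁺ (∈V-respˡ w≐gt w∈Mv)) , t , refl
        region∈ = ∈-filter⁺ realized? (∈-allSubsets (signature (g t))) realized
    in Any.index region∈ , trans (signature-cong w≐gt) (lookup-index region∈)

  F : Fin n → Subset k
  F x = subsetOf λ p → x ∈? region p

  ∈F⇒∈M : ∀ {w p x} → w LiesAt p → p ∈ F x → w ∈V M x
  ∈F⇒∈M {x = x} w-at-p p∈Fx =
    ∈-signature⁻ (subst (x ∈_) (sym w-at-p) (∈-subsetOf⁻ (λ p → x ∈? region p) p∈Fx))

  ∈M⇒∈F : ∀ {w p x} → w LiesAt p → w ∈V M x → p ∈ F x
  ∈M⇒∈F {x = x} w-at-p w∈Mx =
    ∈-subsetOf⁺ (λ p → x ∈? region p) (subst (x ∈_) w-at-p (∈-signature⁺ w∈Mx))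

  record Target (p q r : Fin k) : Set₁ where
    constructor target
    field
      forced   : ForcedNode Φ F p q
      {left}   : V
      {right}  : V
      left-at  : left LiesAt p
      right-at : right LiesAt q
      pair-at  : pairV left right LiesAt r

  Target-sym : ∀ {p q r} → Target p q r → Target q p r
  Target-sym (target forced a-at b-at ab-at) =
    target (ForcedNode-sym forced) b-at a-at (LiesAt-resp (pairV-comm _ _) ab-at)

  T : Fin k → Fin k → Subset k
  T p q = subsetOf λ r → em {Target p q r}

  ∈T⁺ : ∀ {p q r} → Target p q r → r ∈ T p q
  ∈T⁺ = ∈-subsetOf⁺ λ _ → em

  ∈T⁻ : ∀ {p q r} → r ∈ T p q → Target p q r
  ∈T⁻ = ∈-subsetOf⁻ λ _ → em

  graph : OGraph k
  graph = record
    { T = T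
    ; T-sym = λ p q → subsetOf-cong (λ _ → em) (λ _ → em) (mk⇔ Target-sym Target-sym) }

  forced-pair∈M : ∀ {i j a b} → ((x , y , z , _) : ForcedNode Φ F i j) →
    a LiesAt i → b LiesAt j → pairV a b ∈V M x
  forced-pair∈M (x , y , z , lit , u , v , u∈Fy , v∈Fz , inj₁ (refl , refl)) a-at b-at =
    proj₂ (All.lookup M⊨Φ lit _) (_ , _ , ∈F⇒∈M a-at u∈Fy , ∈F⇒∈M b-at v∈Fz , ≐-refl _)
  forced-pair∈M (x , y , z , lit , u , v , u∈Fy , v∈Fz , inj₂ (refl , refl)) a-at b-at =
    ∈V-respˡ (pairV-comm _ _)
      (proj₂ (All.lookup M⊨Φ lit _) (_ , _ , ∈F⇒∈M b-at u∈Fy , ∈F⇒∈M a-at v∈Fz , ≐-refl _))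

  onYes : ∀ {A : Set} → Dec A → (A → ℕ) → ℕ
  onYes (yes a) h = h a
  onYes (no _) _ = 0

  -- Only ∈-chains through the finite domain g are counted, so a finite maximum suffices.
  depth : V → ℕ
  depth (sup I f) =
    max 0 (List.map (λ t → onYes (decide {g t ∈V sup I f}) (suc ∘ depth ∘ f ∘ proj₁)) (List.allFin m))

  depth-cong : ∀ {x y} → x ≐ y → depth x ≡ depth y
  depth-cong {sup I f} {sup J h} x≐y = cong (max 0) (map-cong (λ t → step decide decide) (List.allFin m))
    where
    step : ∀ {t} (a : Dec (g t ∈V sup I f)) (b : Dec (g t ∈V sup J h)) →
      onYes a (suc ∘ depth ∘ f ∘ proj₁) ≡ onYes b (suc ∘ depth ∘ h ∘ proj₁)
    step (yes (i , e)) (yes (j , e′)) = cong suc (depth-cong (≐-trans (≐-sym e) e′))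
    step (yes t∈x) (no t∉y) = ⊥-elim (t∉y (∈V-respʳ x≐y t∈x))
    step (no t∉x) (yes t∈y) = ⊥-elim (t∉x (∈V-respʳ (≐-sym x≐y) t∈y))
    step (no _) (no _) = refl

  ∈-depth-< : ∀ {t w} → g t ∈V w → depth (g t) < depth w
  ∈-depth-< {t} {sup I f} gt∈w = v<max⁺ 0 _ (inj₂ (map⁺ (tabulate⁺ t (below decide))))
    where
    below : (d : Dec (g t ∈V sup I f)) → depth (g t) < onYes d (suc ∘ depth ∘ f ∘ proj₁)
    below (yes (i , gt≐fi)) = s≤s (ℕ.≤-reflexive (depth-cong gt≐fi))
    below (no gt∉w) = ⊥-elim (gt∉w gt∈w)

  _LiesAt?_ : ∀ t p → Dec (g t LiesAt p)
  t LiesAt? p = decide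

  deepest : Fin k → Fin m
  deepest p = argmax (depth ∘ g) (proj₁ (representative p)) (List.filter (_LiesAt? p) (List.allFin m))

  deepest-at : ∀ p → g (deepest p) LiesAt p
  deepest-at p = argmax-all (depth ∘ g) (proj₂ (representative p)) (all-filter (_LiesAt? p) (List.allFin m))

  height : Fin k → ℕ
  height p = depth (g (deepest p))

  depth-≤-height : ∀ {t p} → g t LiesAt p → depth (g t) ≤ height p
  depth-≤-height {t} {p} gt-at = All.lookup (f[xs]≤f[argmax] _ _)
    (∈-filter⁺ (_LiesAt? p) (∈-allFin t) gt-at)

  height-< : ∀ {p q w x} → g (deepest p) ∈V w → w ∈V M x → w LiesAt q → height p < height q
  height-< {q = q} {w} {x} top∈w w∈Mx w-at =
    let t , w≐gt = g-covers x w w∈Mx in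
    ℕ.<-≤-trans (∈-depth-< top∈w)
      (subst (_≤ height q) (depth-cong (≐-sym w≐gt)) (depth-≤-height (LiesAt-resp w≐gt w-at)))

  position : Fin k → ℕ
  position p = code p (height p)

  position-injective : Injective _≡_ _≡_ position
  position-injective {p} {q} = proj₁ ∘ code-injective {p = p} {q} {height p} {height q}

  _≺_ : Fin k → Fin k → Set
  _≺_ = _<_ on position

  ≺-isStrictTotalOrder : IsStrictTotalOrder _≡_ _≺_
  ≺-isStrictTotalOrder = <-on-isStrictTotalOrder position position-injective

  -- Pairing the deepest elements of i and j gives an element deeper than both, at a place of T i j.
  topological : (i j : Fin k) → Nonempty (T i j) → Σ (Fin k) λ q → q ∈ T i j × i ≺ q × j ≺ q
  topological i j (_ , r∈Tij) =
    q , ∈T⁺ (target forced (deepest-at i) (deepest-at j) ab-at) ,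
    code-<-mono i q (height-< (∈-pairV₁ _ _) ab∈Mx ab-at) ,
    code-<-mono j q (height-< (∈-pairV₂ _ _) ab∈Mx ab-at)
    where
    forced = Target.forced (∈T⁻ r∈Tij)
    ab∈Mx = forced-pair∈M forced (deepest-at i) (deepest-at j)
    q = proj₁ (locate ab∈Mx)
    ab-at = proj₂ (locate ab∈Mx)

  accessible-at : ∀ w {p} → w LiesAt p → AccessiblePlace graph p
  accessible-at (sup I f) {p} w-at with decide {Σ (Fin k) λ i → Σ (Fin k) λ j → p ∈ T i j}
  ... | no no-node = source λ i j p∈Tij → no-node (i , j , p∈Tij)
  ... | yes (_ , _ , p∈Tij) =
    let target forced@(x , y , z , lit , _) a-at b-at ab-at = ∈T⁻ p∈Tij
        w∈Mx = ∈F⇒∈M w-at (∈M⇒∈F ab-at (forced-pair∈M forced a-at b-at))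
        c , d , c∈My , d∈Mz , w≐cd = proj₁ (All.lookup M⊨Φ lit _) w∈Mx
        pc , c-at = locate c∈My
        pd , d-at = locate d∈Mz
        i₁ , c≐fi₁ = ∈V-respʳ (≐-sym w≐cd) (∈-pairV₁ c d)
        i₂ , d≐fi₂ = ∈V-respʳ (≐-sym w≐cd) (∈-pairV₂ c d)
        node = pc , pd , ∈M⇒∈F c-at c∈My , ∈M⇒∈F d-at d∈Mz , inj₁ (refl , refl)
    in fire pc pd
         (accessible-at (f i₁) (LiesAt-resp c≐fi₁ c-at))
         (accessible-at (f i₂) (LiesAt-resp d≐fi₂ d-at))
         (∈T⁺ (target (x , y , z , lit , node) c-at d-at (LiesAt-resp w≐cd w-at)))

  fulfils-union : ∀ {x y z} → IsUnion (M x) (M y) (M z) → F x ≡ F y ∪ F z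
  fulfils-union x=y∪z = ⊆-antisym
    (λ {p} p∈Fx → let t , at = representative p in
      x∈p∪q⁺ (Sum.map (∈M⇒∈F at) (∈M⇒∈F at) (proj₁ (x=y∪z (g t)) (∈F⇒∈M at p∈Fx))))
    (λ {p} p∈Fy∪Fz → let t , at = representative p in
      ∈M⇒∈F at (proj₂ (x=y∪z (g t))
        (Sum.map (∈F⇒∈M at) (∈F⇒∈M at) (x∈p∪q⁻ _ _ p∈Fy∪Fz))))

  fulfils-diff : ∀ {x y z} → IsDiff (M x) (M y) (M z) → F x ≡ F y ─ F z
  fulfils-diff {x} {y} {z} x=y∖z = ⊆-antisym
    (λ {p} p∈Fx → let t , at = representative p
                      gt∈My , gt∉Mz = proj₁ (x=y∖z (g t)) (∈F⇒∈M at p∈Fx) in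
      x∈p∧x∉q⇒x∈p─q (∈M⇒∈F at gt∈My) (gt∉Mz ∘ ∈F⇒∈M at))
    (λ {p} p∈Fy─Fz → let t , at = representative p in
      ∈M⇒∈F at (proj₂ (x=y∖z (g t))
        ( ∈F⇒∈M at (p─q⊆p (F y) (F z) p∈Fy─Fz)
        , x∈p─q⇒x∉q (F y) (F z) p∈Fy─Fz ∘ ∈M⇒∈F at)))

  fulfils-neq : ∀ {x y} → ¬ M x ≐ M y → F x ≢ F y
  fulfils-neq {x} {y} Mx≉My Fx≡Fy = Mx≉My (≐-ext (transfer Fx≡Fy) (transfer (sym Fx≡Fy)))
    where
    transfer : ∀ {x y} → F x ≡ F y → ∀ w → w ∈V M x → w ∈V M y
    transfer Fx≡Fy w w∈Mx =
      let p , at = locate w∈Mx in ∈F⇒∈M at (subst (p ∈_) Fx≡Fy (∈M⇒∈F at w∈Mx))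

  fulfils-tensor : ∀ {x y z} → tensor x y z ∈ˡ Φ → FulfillsLit graph F (tensor x y z)
  fulfils-tensor {x} {y} {z} lit = targets-inside , covered , outside-excluded
    where
    x=y⊗z = All.lookup M⊨Φ lit

    targets-inside : (u v : Fin k) → u ∈ F y → v ∈ F z → Nonempty (T u v) × T u v ⊆ F x
    targets-inside u v u∈Fy v∈Fz =
      let forced = x , y , z , lit , u , v , u∈Fy , v∈Fz , inj₁ (refl , refl)
          _ , a-at = representative u
          _ , b-at = representative v
          q , ab-at = locate (forced-pair∈M forced a-at b-at)
      in (q , ∈T⁺ (target forced a-at b-at ab-at)) ,
         λ r∈Tuv → let target _ a′-at b′-at ab′-at = ∈T⁻ r∈Tuv in
           ∈M⇒∈F ab′-at (forced-pair∈M forced a′-at b′-at)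

    covered : (p : Fin k) → p ∈ F x →
      Σ (Fin k) λ i → Σ (Fin k) λ j → Node⊗ (F y) (F z) i j × p ∈ T i j
    covered p p∈Fx =
      let t , at = representative p
          a , b , a∈My , b∈Mz , gt≐ab = proj₁ (x=y⊗z (g t)) (∈F⇒∈M at p∈Fx)
          i , a-at = locate a∈My
          j , b-at = locate b∈Mz
          node = i , j , ∈M⇒∈F a-at a∈My , ∈M⇒∈F b-at b∈Mz , inj₁ (refl , refl)
      in i , j , node , ∈T⁺ (target (x , y , z , lit , node) a-at b-at (LiesAt-resp gt≐ab at))

    outside-excluded : (i j : Fin k) → ¬ Node⊗ (F y) (F z) i j → (p : Fin k) → p ∈ T i j → p ∉ F x
    outside-excluded i j not-node p p∈Tij p∈Fx with ∈T⁻ p∈Tij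
    ... | target _ a-at b-at ab-at with proj₁ (x=y⊗z _) (∈F⇒∈M ab-at p∈Fx)
    ... | c , d , c∈My , d∈Mz , ab≐cd with pairV-injective ab≐cd
    ... | inj₁ (a≐c , b≐d) = not-node (i , j ,
      ∈M⇒∈F a-at (∈V-respˡ (≐-sym a≐c) c∈My) ,
      ∈M⇒∈F b-at (∈V-respˡ (≐-sym b≐d) d∈Mz) , inj₁ (refl , refl))
    ... | inj₂ (a≐d , b≐c) = not-node (j , i ,
      ∈M⇒∈F b-at (∈V-respˡ (≐-sym b≐c) c∈My) ,
      ∈M⇒∈F a-at (∈V-respˡ (≐-sym a≐d) d∈Mz) , inj₂ (refl , refl))

  fulfils : ∀ {ℓ} → ℓ ∈ˡ Φ → FulfillsLit graph F ℓ
  fulfils {union x y z} lit = fulfils-union (All.lookup M⊨Φ lit)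
  fulfils {diff x y z} lit = fulfils-diff (All.lookup M⊨Φ lit)
  fulfils {tensor x y z} lit = fulfils-tensor lit
  fulfils {neq x y} lit = fulfils-neq (lower (All.lookup M⊨Φ lit))

  fulfilledBySmallGraph : FulfilledBySmallGraph Φ
  fulfilledBySmallGraph =
    k , k≤2^n∸1 , graph ,
    (λ p → let t , at = representative p in accessible-at (g t) at) ,
    record { _≺_ = _≺_ ; isSTO = ≺-isStrictTotalOrder ; topo = topological } ,
    F , All.tabulate fulfils

Finite⇒SmallGraph : ExcludedMiddle (lsuc 0ℓ) → ∀ {n} {Φ : Conj n} →
  FinitelySatisfiable Φ → FulfilledBySmallGraph Φ
Finite⇒SmallGraph em {Φ = Φ} (M , M⊨Φ , _ , g , g-covers) =
  VennGraph.fulfilledBySmallGraph em Φ M M⊨Φ g g-covers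

module GraphModel (em : ExcludedMiddle (lsuc 0ℓ)) {n} (Φ : Conj n) {k} (G : OGraph k)
  (acc : Accessible G) (order : TopologicalOrder G)
  (F : Fin n → Subset k) (G⊨Φ : All (FulfillsLit G F) Φ) where

  open OGraph G
  open TopologicalOrder order
  module ≺ = IsStrictTotalOrder isSTO

  Nonempty-sym : ∀ {i j} → Nonempty (T i j) → Nonempty (T j i)
  Nonempty-sym {i} {j} = subst Nonempty (T-sym i j)

  forced-nonempty : ∀ {i j} → ForcedNode Φ F i j → Nonempty (T i j)
  forced-nonempty (_ , _ , _ , lit , u , v , u∈Fy , v∈Fz , inj₁ (refl , refl)) =
    proj₁ (proj₁ (All.lookup G⊨Φ lit) u v u∈Fy v∈Fz)
  forced-nonempty (_ , _ , _ , lit , u , v , u∈Fy , v∈Fz , inj₂ (refl , refl)) =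
    Nonempty-sym (proj₁ (proj₁ (All.lookup G⊨Φ lit) u v u∈Fy v∈Fz))

  IsApex : Fin k → Fin k → Fin k → Set
  IsApex i j q = q ∈ T i j × i ≺ q × j ≺ q

  highest : Fin k × Fin k → Fin k
  highest (i , j) with nonempty? (T i j)
  ... | yes ne = proj₁ (topo i j ne)
  ... | no _ = i

  highest-apex : ∀ i j → Nonempty (T i j) → IsApex i j (highest (i , j))
  highest-apex i j ne with nonempty? (T i j)
  ... | yes ne′ = proj₂ (topo i j ne′)
  ... | no empty = ⊥-elim (empty ne)

  -- Symmetric in i and j, since a pair {u,v} does not record the order of its components.
  apex : Fin k → Fin k → Fin k
  apex i j = highest (sort i j)

  apex-comm : ∀ i j → apex i j ≡ apex j i
  apex-comm i j = cong highest (sort-comm i j)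

  apex-isApex : ∀ {i j} → Nonempty (T i j) → IsApex i j (apex i j)
  apex-isApex {i} {j} ne with sort i j | sort-cases i j
  ... | _ | inj₁ refl = highest-apex i j ne
  ... | _ | inj₂ refl =
    let q∈Tji , j≺q , i≺q = highest-apex j i (Nonempty-sym ne) in
    subst (highest (j , i) ∈_) (T-sym j i) q∈Tji , i≺q , j≺q

  rank : Fin k → ℕ
  rank r = ∣ subsetOf (≺._<? r) ∣

  rank-mono : ∀ {q r} → q ≺ r → rank q < rank r
  rank-mono {q} {r} q≺r = p⊂q⇒∣p∣<∣q∣
    ( ∈-subsetOf⁺ (≺._<? r) ∘ (λ p≺q → ≺.trans p≺q q≺r) ∘ ∈-subsetOf⁻ (≺._<? q)
    , q , ∈-subsetOf⁺ (≺._<? r) q≺r , ≺.irrefl refl ∘ ∈-subsetOf⁻ (≺._<? q))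

  rank<k : ∀ r → rank r < k
  rank<k r = subst (rank r <_) (∣⊤∣≡n k)
    (p⊂q⇒∣p∣<∣q∣ (⊆⊤ , r , ∈⊤ , ≺.irrefl refl ∘ ∈-subsetOf⁻ (≺._<? r)))

  -- The counter keeps seeds apart: atoms encode (place, counter), and the right
  -- component of a fired seed gets a counter that is never 0.
  seed : ∀ {p} → AccessiblePlace G p → ℕ → V
  seed {p} (source _) c = atom (code p c)
  seed {p} (fire _ _ ai aj _) c = pairV (seed ai 0) (seed aj (suc (code p c)))

  seed-injective : ∀ {p p′} (d : AccessiblePlace G p) (d′ : AccessiblePlace G p′) {c c′} →
    seed d c ≐ seed d′ c′ → p ≡ p′ × c ≡ c′
  seed-injective (source _) (source _) e = code-injective (atom-injective _ _ e)
  seed-injective (source _) (fire _ _ _ _ _) e = ⊥-elim (atom-≉-pairV _ _ _ e)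
  seed-injective (fire _ _ _ _ _) (source _) e = ⊥-elim (atom-≉-pairV _ _ _ (≐-sym e))
  seed-injective (fire _ _ ai aj _) (fire _ _ ai′ aj′ _) e with pairV-injective e
  ... | inj₁ (_ , right≐right′) =
    code-injective (ℕ.suc-injective (proj₂ (seed-injective aj aj′ right≐right′)))
  ... | inj₂ (left≐right′ , _) with () ← proj₂ (seed-injective ai aj′ left≐right′)

  seed-HF : ∀ {p} (d : AccessiblePlace G p) c → IsHF (seed d c)
  seed-HF (source _) c = atom-HF _
  seed-HF (fire _ _ ai aj _) c = pairV-HF (seed-HF ai 0) (seed-HF aj _)

  seedTree : ∀ {p} → AccessiblePlace G p → ℕ → List (Fin k × V)
  seedTree {p} d@(source _) c = List.[ p , seed d c ]
  seedTree {p} d@(fire _ _ ai aj _) c = (p , seed d c) ∷ seedTree ai 0 ++ seedTree aj (suc (code p c))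

  root∈seedTree : ∀ {p} (d : AccessiblePlace G p) c → (p , seed d c) ∈ˡ seedTree d c
  root∈seedTree (source _) c = here refl
  root∈seedTree (fire _ _ _ _ _) c = here refl

  SeedOf : List (Fin k × V) → Fin k × V → Set₁
  SeedOf S (q , s) = Σ (AccessiblePlace G q) λ d → Σ ℕ λ c → s ≡ seed d c × seedTree d c ⊆ˡ S

  SeedOf-mono : ∀ {S S′ x} → S ⊆ˡ S′ → SeedOf S x → SeedOf S′ x
  SeedOf-mono S⊆S′ (d , c , s≡ , tree⊆S) = d , c , s≡ , S⊆S′ ∘ tree⊆S

  seedTree-closed : ∀ {p} (d : AccessiblePlace G p) c {x} → x ∈ˡ seedTree d c → SeedOf (seedTree d c) x
  seedTree-closed d@(source _) c (here refl) = d , c , refl , id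
  seedTree-closed d@(fire _ _ _ _ _) c (here refl) = d , c , refl , id
  seedTree-closed (fire _ _ ai aj _) c (there x∈) with ∈-++⁻ (seedTree ai 0) x∈
  ... | inj₁ x∈ai = SeedOf-mono (there ∘ ∈-++⁺ˡ) (seedTree-closed ai 0 x∈ai)
  ... | inj₂ x∈aj = SeedOf-mono (there ∘ ∈-++⁺ʳ (seedTree ai 0)) (seedTree-closed aj _ x∈aj)

  allSeeds : List (Fin k × V)
  allSeeds = concat (List.tabulate λ p → seedTree (acc p) 0)

  allSeeds-closed : ∀ {x} → x ∈ˡ allSeeds → SeedOf allSeeds x
  allSeeds-closed x∈ with ∈-concat⁻′ (List.tabulate λ p → seedTree (acc p) 0) x∈
  ... | _ , x∈tree , tree∈ with ∈-tabulate⁻ tree∈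
  ... | p , refl =
    SeedOf-mono (λ y∈ → ∈-concat⁺′ y∈ tree∈) (seedTree-closed (acc p) 0 x∈tree)

  root∈allSeeds : ∀ p → (p , seed (acc p) 0) ∈ˡ allSeeds
  root∈allSeeds p = ∈-concat⁺′ (root∈seedTree (acc p) 0) (∈-tabulate⁺ p)

  IsSeed : V → Set₁
  IsSeed w = Σ (Fin k × V) λ x → x ∈ˡ allSeeds × w ≐ proj₂ x

  record Cascaded (E : Fin k → List V) (r : Fin k) (w : V) : Set₁ where
    constructor cascaded
    field
      {i j}  : Fin k
      forced : ForcedNode Φ F i j
      apex≡r : apex i j ≡ r
      {u v}  : V
      u∈Eᵢ   : u ∈ˡ E i
      v∈Eⱼ   : v ∈ˡ E j
      w≡uv   : w ≡ pairV u v
      fresh  : ¬ IsSeed w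

  Belongs : (Fin k → List V) → Fin k → V → Set₁
  Belongs E r w = (r , w) ∈ˡ allSeeds ⊎ Cascaded E r w

  Belongs-mono : ∀ {E E′ r w} → (∀ {j} → j ≺ r → E j ⊆ˡ E′ j) → Belongs E r w → Belongs E′ r w
  Belongs-mono _ (inj₁ seed∈) = inj₁ seed∈
  Belongs-mono E⊆E′ (inj₂ (cascaded forced refl u∈ v∈ w≡uv fresh)) =
    let _ , i≺ , j≺ = apex-isApex (forced-nonempty forced) in
    inj₂ (cascaded forced refl (E⊆E′ i≺ u∈) (E⊆E′ j≺ v∈) w≡uv fresh)

  candidates : (Fin k → List V) → List V
  candidates E = List.map proj₂ allSeeds ++ cartesianProductWith pairV everything everything
    where everything = concat (List.tabulate E)

  ∈-candidates : ∀ {E r w} → Belongs E r w → w ∈ˡ candidates E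
  ∈-candidates (inj₁ seed∈) = ∈-++⁺ˡ (∈-map⁺ proj₂ seed∈)
  ∈-candidates {E} (inj₂ (cascaded {i} {j} _ _ u∈ v∈ refl _)) = ∈-++⁺ʳ (List.map proj₂ allSeeds)
    (∈-cartesianProductWith⁺ pairV (∈-concat⁺′ u∈ (∈-tabulate⁺ i)) (∈-concat⁺′ v∈ (∈-tabulate⁺ j)))

  -- Stage t is already final at the places of rank below t, so stage k + 1 is final everywhere.
  stage : ℕ → Fin k → List V
  stage zero _ = []
  stage (suc t) r = List.filter (λ w → em {Belongs (stage t) r w}) (candidates (stage t))

  ∈-stage⁺ : ∀ t {r w} → Belongs (stage t) r w → w ∈ˡ stage (suc t) r
  ∈-stage⁺ t b = ∈-filter⁺ (λ _ → em) (∈-candidates b) b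

  ∈-stage⁻ : ∀ t {r w} → w ∈ˡ stage (suc t) r → Belongs (stage t) r w
  ∈-stage⁻ t = proj₂ ∘ ∈-filter⁻ (λ _ → em) {xs = candidates (stage t)}

  stage-stable : ∀ t r → rank r < t → stage t r ⊆ˡ stage (suc t) r × stage (suc t) r ⊆ˡ stage t r
  stage-stable (suc t) r rank<1+t =
    ∈-stage⁺ (suc t) ∘ Belongs-mono (λ j≺r → proj₁ (stage-stable t _ (below j≺r))) ∘ ∈-stage⁻ t ,
    ∈-stage⁺ t ∘ Belongs-mono (λ j≺r → proj₂ (stage-stable t _ (below j≺r))) ∘ ∈-stage⁻ (suc t)
    where
    below : ∀ {j} → j ≺ r → rank j < t
    below j≺r = ℕ.<-≤-trans (rank-mono j≺r) (ℕ.≤-pred rank<1+t)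

  elements : Fin k → List V
  elements = stage (suc k)

  elements⁺ : ∀ {r w} → Belongs elements r w → w ∈ˡ elements r
  elements⁺ = ∈-stage⁺ k ∘ Belongs-mono (λ {j} _ → proj₂ (stage-stable k j (rank<k j)))

  elements⁻ : ∀ {r w} → w ∈ˡ elements r → Belongs elements r w
  elements⁻ = Belongs-mono (λ {j} _ → proj₁ (stage-stable k j (rank<k j))) ∘ ∈-stage⁻ k

  seedOf : ∀ {r w} → (r , w) ∈ˡ allSeeds → Σ (AccessiblePlace G r) λ d → Σ ℕ λ c → w ≡ seed d c
  seedOf s∈ = let d , c , w≡ , _ = allSeeds-closed s∈ in d , c , w≡

  UniquelyPlaced : V → Set₁
  UniquelyPlaced e = ∀ {r r′ e′} → e ∈ˡ elements r → e′ ∈ˡ elements r′ → e ≐ e′ → r ≡ r′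

  place-unique : ∀ e → UniquelyPlaced e
  place-unique = ⊏-ind UniquelyPlaced step
    where
    step : ∀ e → (∀ u → u ⊏ e → UniquelyPlaced u) → UniquelyPlaced e
    step e IH e∈ e′∈ e≐e′ with elements⁻ e∈ | elements⁻ e′∈
    ... | inj₁ s∈ | inj₁ s′∈ with seedOf s∈ | seedOf s′∈
    ...   | d , _ , refl | d′ , _ , refl = proj₁ (seed-injective d d′ e≐e′)
    step e IH e∈ e′∈ e≐e′ | inj₁ s∈ | inj₂ c′ = ⊥-elim (Cascaded.fresh c′ (_ , s∈ , ≐-sym e≐e′))
    step e IH e∈ e′∈ e≐e′ | inj₂ c | inj₁ s′∈ = ⊥-elim (Cascaded.fresh c (_ , s′∈ , e≐e′))
    step e IH e∈ e′∈ e≐e′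
      | inj₂ (cascaded _ refl u∈ v∈ e≡uv _) | inj₂ (cascaded {i′} {j′} _ refl u′∈ v′∈ refl _)
      with pairV-injective (subst (_≐ _) e≡uv e≐e′)
    ... | inj₁ (u≐u′ , v≐v′) =
      cong₂ apex (IH _ (⊏-pairV₁ e≡uv) u∈ u′∈ u≐u′) (IH _ (⊏-pairV₂ e≡uv) v∈ v′∈ v≐v′)
    ... | inj₂ (u≐v′ , v≐u′) =
      trans (cong₂ apex (IH _ (⊏-pairV₁ e≡uv) u∈ v′∈ u≐v′) (IH _ (⊏-pairV₂ e≡uv) v∈ u′∈ v≐u′))
            (apex-comm j′ i′)

  Resides : V → Fin k → Set₁
  Resides w r = Σ V λ e → e ∈ˡ elements r × w ≐ e

  resides : ∀ {e r} → e ∈ˡ elements r → Resides e r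
  resides e∈ = _ , e∈ , ≐-refl _

  Resides-resp : ∀ {w w′ r} → w ≐ w′ → Resides w r → Resides w′ r
  Resides-resp w≐w′ (e , e∈ , w≐e) = e , e∈ , ≐-trans (≐-sym w≐w′) w≐e

  resides-unique : ∀ {w r r′} → Resides w r → Resides w r′ → r ≡ r′
  resides-unique (e , e∈ , w≐e) (e′ , e′∈ , w≐e′) =
    place-unique e e∈ e′∈ (≐-join (≐-sym w≐e) (≐-sym w≐e′))

  record FiredPair (r : Fin k) (e : V) : Set₁ where
    constructor fired
    field
      {i j} : Fin k
      {u v} : V
      u∈Eᵢ  : u ∈ˡ elements i
      v∈Eⱼ  : v ∈ˡ elements j
      e≡uv  : e ≡ pairV u v
      r∈Tij : r ∈ T i j

  seed-cases : ∀ {q s} → (q , s) ∈ˡ allSeeds →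
    (IsSource G q × Σ ℕ λ c → s ≡ atom (code q c)) ⊎ FiredPair q s
  seed-cases s∈ with allSeeds-closed s∈
  ... | source src , c , refl , _ = inj₁ (src , c , refl)
  ... | fire _ _ ai aj q∈Tij , c , refl , tree⊆ = inj₂ (fired
    (elements⁺ (inj₁ (tree⊆ (there (∈-++⁺ˡ (root∈seedTree ai 0))))))
    (elements⁺ (inj₁ (tree⊆ (there (∈-++⁺ʳ (seedTree ai 0) (root∈seedTree aj _))))))
    refl q∈Tij)

  decompose : ∀ {r e} → e ∈ˡ elements r → ¬ IsSource G r → FiredPair r e
  decompose e∈ non-source with elements⁻ e∈
  ... | inj₂ (cascaded forced refl u∈ v∈ e≡uv _) =
    fired u∈ v∈ e≡uv (proj₁ (apex-isApex (forced-nonempty forced)))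
  ... | inj₁ s∈ with seed-cases s∈
  ...   | inj₁ (src , _) = ⊥-elim (non-source src)
  ...   | inj₂ e-fired = e-fired

  pair-resides : ∀ {i j u v} → Resides u i → Resides v j → ForcedNode Φ F i j →
    Σ (Fin k) λ s → Resides (pairV u v) s × s ∈ T i j
  pair-resides {i} {j} (eu , eu∈ , u≐eu) (ev , ev∈ , v≐ev) forced with em {IsSeed (pairV eu ev)}
  ... | no fresh =
    apex i j ,
    (pairV eu ev , elements⁺ (inj₂ (cascaded forced refl eu∈ ev∈ refl fresh)) , pairV-cong u≐eu v≐ev) ,
    proj₁ (apex-isApex (forced-nonempty forced))
  ... | yes ((q , s) , s∈ , pair≐s) with seed-cases s∈
  ...   | inj₁ (_ , _ , refl) = ⊥-elim (atom-≉-pairV _ _ _ (≐-sym pair≐s))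
  ...   | inj₂ (fired a∈ b∈ refl q∈Tab) =
    q , (s , elements⁺ (inj₁ s∈) , ≐-trans (pairV-cong u≐eu v≐ev) pair≐s) ,
    same-node (pairV-injective pair≐s)
    where
    same-node : _ → q ∈ T i j
    same-node (inj₁ (eu≐a , ev≐b)) =
      subst₂ (λ i j → q ∈ T i j)
        (place-unique _ a∈ eu∈ (≐-sym eu≐a)) (place-unique _ b∈ ev∈ (≐-sym ev≐b)) q∈Tab
    same-node (inj₂ (eu≐b , ev≐a)) =
      subst (q ∈_) (T-sym j i)
        (subst₂ (λ i j → q ∈ T i j)
          (place-unique _ a∈ ev∈ (≐-sym ev≐a)) (place-unique _ b∈ eu∈ (≐-sym eu≐b)) q∈Tab)

  elements-HF : ∀ e {r} → e ∈ˡ elements r → IsHF e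
  elements-HF = ⊏-ind (λ e → ∀ {r} → e ∈ˡ elements r → IsHF e) step
    where
    step : ∀ e → (∀ u → u ⊏ e → ∀ {r} → u ∈ˡ elements r → IsHF u) →
      ∀ {r} → e ∈ˡ elements r → IsHF e
    step e IH e∈ with elements⁻ e∈
    ... | inj₁ s∈ with seedOf s∈
    ...   | d , c , refl = seed-HF d c
    step e IH e∈ | inj₂ (cascaded _ _ u∈ v∈ e≡uv _) =
      subst IsHF (sym e≡uv) (pairV-HF (IH _ (⊏-pairV₁ e≡uv) u∈) (IH _ (⊏-pairV₂ e≡uv) v∈))

  members : Fin n → List V
  members x = concat (List.map elements (List.filter (_∈? F x) (List.allFin k)))

  ∈-members⁻ : ∀ {x e} → e ∈ˡ members x → Σ (Fin k) λ r → r ∈ F x × e ∈ˡ elements r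
  ∈-members⁻ {x} e∈ with ∈-concat⁻′ (List.map elements _) e∈
  ... | _ , e∈Es , Es∈ with ∈-map⁻ elements Es∈
  ...   | r , r∈ , refl = r , proj₂ (∈-filter⁻ (_∈? F x) {xs = List.allFin k} r∈) , e∈Es

  model : Fin n → V
  model x = listSet (members x)

  ∈-model⁺ : ∀ {x r w} → r ∈ F x → Resides w r → w ∈V model x
  ∈-model⁺ {x} {r} r∈Fx (e , e∈ , w≐e) =
    ∈-listSet⁺ (∈-concat⁺′ e∈ (∈-map⁺ elements (∈-filter⁺ (_∈? F x) (∈-allFin r) r∈Fx))) w≐e

  ∈-model⁻ : ∀ {x w} → w ∈V model x → Σ (Fin k) λ r → r ∈ F x × Resides w r
  ∈-model⁻ w∈ with ∈-listSet⁻ w∈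
  ... | e , e∈ , w≐e with ∈-members⁻ e∈
  ...   | r , r∈Fx , e∈Eᵣ = r , r∈Fx , e , e∈Eᵣ , w≐e

  model-HF : ∀ x → IsHF (model x)
  model-HF x = listSet-HF {xs = members x} λ e∈ →
    let _ , _ , e∈Eᵣ = ∈-members⁻ e∈ in elements-HF _ e∈Eᵣ

  holds-union : ∀ {x y z} → F x ≡ F y ∪ F z → IsUnion (model x) (model y) (model z)
  holds-union {x} {y} {z} Fx≡Fy∪Fz w =
    (λ w∈Mx → let r , r∈Fx , w-at-r = ∈-model⁻ w∈Mx in
      Sum.map (λ r∈Fy → ∈-model⁺ r∈Fy w-at-r) (λ r∈Fz → ∈-model⁺ r∈Fz w-at-r)
        (x∈p∪q⁻ (F y) (F z) (subst (r ∈_) Fx≡Fy∪Fz r∈Fx))) ,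
    [ (λ w∈My → let r , r∈Fy , w-at-r = ∈-model⁻ w∈My in
        ∈-model⁺ (subst (r ∈_) (sym Fx≡Fy∪Fz) (x∈p∪q⁺ (inj₁ r∈Fy))) w-at-r)
    , (λ w∈Mz → let r , r∈Fz , w-at-r = ∈-model⁻ w∈Mz in
        ∈-model⁺ (subst (r ∈_) (sym Fx≡Fy∪Fz) (x∈p∪q⁺ (inj₂ r∈Fz))) w-at-r) ]′

  holds-diff : ∀ {x y z} → F x ≡ F y ─ F z → IsDiff (model x) (model y) (model z)
  holds-diff {x} {y} {z} Fx≡Fy─Fz w =
    (λ w∈Mx → let r , r∈Fx , w-at-r = ∈-model⁻ w∈Mx ; r∈Fy─Fz = subst (r ∈_) Fx≡Fy─Fz r∈Fx in
      ∈-model⁺ (p─q⊆p (F y) (F z) r∈Fy─Fz) w-at-r ,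
      λ w∈Mz → let r′ , r′∈Fz , w-at-r′ = ∈-model⁻ w∈Mz in
        x∈p─q⇒x∉q (F y) (F z) r∈Fy─Fz (subst (_∈ F z) (resides-unique w-at-r′ w-at-r) r′∈Fz)) ,
    λ (w∈My , w∉Mz) → let r , r∈Fy , w-at-r = ∈-model⁻ w∈My in
      ∈-model⁺ (subst (r ∈_) (sym Fx≡Fy─Fz) (x∈p∧x∉q⇒x∈p─q r∈Fy (w∉Mz ∘ flip ∈-model⁺ w-at-r)))
        w-at-r

  holds-neq : ∀ {x y} → F x ≢ F y → ¬ model x ≐ model y
  holds-neq Fx≢Fy Mx≐My = Fx≢Fy (⊆-antisym (transfer Mx≐My) (transfer (≐-sym Mx≐My)))
    where
    transfer : ∀ {x y} → model x ≐ model y → F x ⊆ F y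
    transfer Mx≐My {r} r∈Fx =
      let inhabitant = resides (elements⁺ (inj₁ (root∈allSeeds r)))
          r′ , r′∈Fy , w-at-r′ = ∈-model⁻ (∈V-respʳ Mx≐My (∈-model⁺ r∈Fx inhabitant))
      in subst (_∈ F _) (resides-unique w-at-r′ inhabitant) r′∈Fy

  holds-tensor : ∀ {x y z} → tensor x y z ∈ˡ Φ → FulfillsLit G F (tensor x y z) →
    IsTensor (model x) (model y) (model z)
  holds-tensor {x} {y} {z} lit (targets-inside , covered , outside-excluded) w = to , from
    where
    to : w ∈V model x → InTensorV w (model y) (model z)
    to w∈Mx with ∈-model⁻ w∈Mx
    ... | r , r∈Fx , e , e∈ , w≐e
      with decompose e∈ (λ src → let i , j , _ , r∈Tij = covered r r∈Fx in src i j r∈Tij)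
    ... | fired {i} {j} {u} {v} u∈ v∈ refl r∈Tij with lowerEM em {Node⊗ (F y) (F z) i j}
    ... | no not-node = ⊥-elim (outside-excluded i j not-node r r∈Tij r∈Fx)
    ... | yes (_ , _ , i∈Fy , j∈Fz , inj₁ (refl , refl)) =
      u , v , ∈-model⁺ i∈Fy (resides u∈) , ∈-model⁺ j∈Fz (resides v∈) , w≐e
    ... | yes (_ , _ , j∈Fy , i∈Fz , inj₂ (refl , refl)) =
      v , u , ∈-model⁺ j∈Fy (resides v∈) , ∈-model⁺ i∈Fz (resides u∈) , ≐-trans w≐e (pairV-comm u v)

    from : InTensorV w (model y) (model z) → w ∈V model x
    from (a , b , a∈My , b∈Mz , w≐ab) with ∈-model⁻ a∈My | ∈-model⁻ b∈Mz
    ... | i , i∈Fy , a-at-i | j , j∈Fz , b-at-j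
      with pair-resides a-at-i b-at-j (x , y , z , lit , i , j , i∈Fy , j∈Fz , inj₁ (refl , refl))
    ... | s , ab-at-s , s∈Tij =
      ∈-model⁺ (proj₂ (targets-inside i j i∈Fy j∈Fz) s∈Tij) (Resides-resp (≐-sym w≐ab) ab-at-s)

  holds : ∀ {ℓ} → ℓ ∈ˡ Φ → HoldsV model ℓ
  holds {union x y z} lit = holds-union (All.lookup G⊨Φ lit)
  holds {diff x y z} lit = holds-diff (All.lookup G⊨Φ lit)
  holds {tensor x y z} lit = holds-tensor lit (All.lookup G⊨Φ lit)
  holds {neq x y} lit = lift (holds-neq (All.lookup G⊨Φ lit))

  herFinSatisfiable : HerFinSatisfiable Φ
  herFinSatisfiable = model , All.tabulate holds , model-HF

SmallGraph⇒HF : ExcludedMiddle (lsuc 0ℓ) → ∀ {n} {Φ : Conj n} →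
  FulfilledBySmallGraph Φ → HerFinSatisfiable Φ
SmallGraph⇒HF em {Φ = Φ} (_ , _ , G , acc , order , F , G⊨Φ) =
  GraphModel.herFinSatisfiable em Φ G acc order F G⊨Φ

theorem4 : ExcludedMiddle (lsuc 0ℓ) →
    (n : ℕ) (Φ : Conj n) → AllVarsOccur Φ →
    (FinitelySatisfiable Φ ⇔ HerFinSatisfiable Φ) ×
    (FinitelySatisfiable Φ ⇔ FulfilledBySmallGraph Φ) ×
    (HerFinSatisfiable Φ ⇔ FulfilledBySmallGraph Φ)
theorem4 em n Φ _ =
  mk⇔ (SmallGraph⇒HF em ∘ Finite⇒SmallGraph em) HF⇒Finite ,
  mk⇔ (Finite⇒SmallGraph em) (HF⇒Finite ∘ SmallGraph⇒HF em) ,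
  mk⇔ (Finite⇒SmallGraph em ∘ HF⇒Finite) (SmallGraph⇒HF em)
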